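{- Let $A$ be an $m\times n$ matrix over a field $\mathbb{K}$. The zero-one symmetrization matrix $\tilde A$ of $A$ is irreducible if and only if there exists a set of pairs $Y=\{\{k_1,l_1\},\dots,\{k_t,l_t\}\}$ which is connected for $A$ and satisfies $[n]=\{k_1,l_1\}\cup\dots\cup\{k_t,l_t\}$.
   Context: For $A=(a_{i,j})$, let $\bar A=(\bar a_{i,j})$ be the $0/1$ integer matrix of the same size with $\bar a_{i,j}=0$ if $a_{i,j}=0$ and $\bar a_{i,j}=1$ otherwise. The zero-one symmetrization of $A$ is the $(m+n)\times(m+n)$ symmetric matrix $\tilde A=\begin{pmatrix}0&\bar A\\ \bar A^T&0\end{pmatrix}$. A symmetric matrix is irreducible if and only if the (undirected) graph having it as adjacency matrix is connected. For a row $a_j$ of $A$, $\mathrm{supp}(a_j)$ is the set of column indices of its nonzero entries, and $[n]=\{1,\dots,n\}$. A set of pairs $Y=\{\{k_1,l_1\},\dots,\{k_t,l_t\}\}$ with $1\le k_i,l_i\le n$ is called connected for $A$ if (i) for each $i$ there exists a row $a_j$ of $A$ with $\{k_i,l_i\}\subseteq\mathrm{supp}(a_j)$, and (ii) for all nonempty $Y_1,Y_2$ with $Y=Y_1\cup Y_2$ there exist $\{\hat k,\hat l\}\in Y_1$ and $\{\bar k,\bar l\}\in Y_2$ with $\hat k=\bar k$.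
   Formalization: The equivalence is asserted only for A with at least one row and no zero row, that is, with $\mathrm{supp}(a_j)$ nonempty for every row $a_j$. The statement above fails without it. -}

module Defs where

open import Level using (Level; _⊔_; suc; Lift)
open import Data.Empty using (⊥)
open import Algebra.Bundles using (CommutativeRing)
open import Data.Nat using (ℕ; _+_)
open import Data.Fin using (Fin; splitAt)
open import Data.Sum using (_⊎_; inj₁; inj₂)
open import Data.Product using (_×_; Σ; ∃; ∃-syntax; _,_; proj₁; proj₂)
open import Data.List using (List; []; _∷_)
open import Data.List.Membership.Propositional using (_∈_)
open import Relation.Nullary using (¬_)
open import Relation.Binary.PropositionalEquality using (_≡_)
open import Relation.Binary.Construct.Closure.ReflexiveTransitive using (Star)

record Field (c ℓ : Level) : Set (Level.suc (c ⊔ ℓ)) where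
  field
    commutativeRing : CommutativeRing c ℓ
  open CommutativeRing commutativeRing public
  field
    1≉0     : ¬ (1# ≈ 0#)
    inverse : ∀ x → ¬ (x ≈ 0#) → ∃[ y ] (x * y ≈ 1#)

module _ {c ℓ : Level} (K : Field c ℓ) where
  open Field K using (Carrier; _≈_; 0#)

  Matrix : ℕ → ℕ → Set c
  Matrix m n = Fin m → Fin n → Carrier

  -- the 0/1 matrix  Ā  (ā_ij = 0 if a_ij = 0, and 1 otherwise), given as a
  -- relation on indices:  Ā i j ≡ 1  iff  a_ij ≠ 0.
  -- We record the 0/1 entries as a proposition "entry equals 1".
  Bar1 : ∀ {m n} → Matrix m n → Fin m → Fin n → Set ℓ
  Bar1 A i j = ¬ (A i j ≈ 0#)

  -- Zero-one symmetrization  Ã = [[0, Ā], [Āᵀ, 0]]  of size (m+n)×(m+n);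
  -- indices  0..m-1 are rows of A, indices m..m+n-1 are columns of A.
  -- SymOne A u v  holds iff the (u,v) entry of Ã equals 1 (otherwise it is 0).
  SymOne : ∀ {m n} → Matrix m n → Fin (m + n) → Fin (m + n) → Set ℓ
  SymOne {m} {n} A u v with splitAt m u | splitAt m v
  ... | inj₁ i | inj₁ i' = Lift ℓ ⊥
  ... | inj₁ i | inj₂ j  = Bar1 A i j
  ... | inj₂ j | inj₁ i  = Bar1 A i j
  ... | inj₂ j | inj₂ j' = Lift ℓ ⊥

  -- A symmetric matrix is irreducible iff the undirected graph having it as
  -- adjacency matrix is connected: every two vertices are joined by a walk.
  IrreducibleSym : ∀ {N} → (Fin N → Fin N → Set ℓ) → Set ℓ
  IrreducibleSym {N} Adj = ∀ (u v : Fin N) → Star Adj u v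

  ZeroOneSymIrreducible : ∀ {m n} → Matrix m n → Set ℓ
  ZeroOneSymIrreducible {m} {n} A = IrreducibleSym (SymOne A)

  InSupp : ∀ {m n} → Matrix m n → Fin m → Fin n → Set ℓ
  InSupp A j k = ¬ (A j k ≈ 0#)

  -- A set of pairs {k,l} (k,l ∈ [n]) is represented by a list of ordered
  -- pairs (k , l) standing for the unordered pair {k,l}; sets are compared
  -- via membership.
  Pairs : ℕ → Set
  Pairs n = List (Fin n × Fin n)

  NonEmpty : ∀ {n} → Pairs n → Set
  NonEmpty Y = ∃[ p ] (p ∈ Y)

  IsUnion : ∀ {n} → Pairs n → Pairs n → Pairs n → Set
  IsUnion Y Y₁ Y₂ = ∀ p → (p ∈ Y → p ∈ Y₁ ⊎ p ∈ Y₂) × (p ∈ Y₁ ⊎ p ∈ Y₂ → p ∈ Y)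

  ShareElem : ∀ {n} → Fin n × Fin n → Fin n × Fin n → Set
  ShareElem (k , l) (k' , l') = (k ≡ k' ⊎ k ≡ l') ⊎ (l ≡ k' ⊎ l ≡ l')

  ConnectedFor : ∀ {m n} → Matrix m n → Pairs n → Set ℓ
  ConnectedFor {m} {n} A Y =
    (∀ {k l} → (k , l) ∈ Y → ∃[ j ] (InSupp A j k × InSupp A j l))
    × (∀ (Y₁ Y₂ : Pairs n) → NonEmpty Y₁ → NonEmpty Y₂ → IsUnion Y Y₁ Y₂ →
         ∃[ p ] ∃[ q ] (p ∈ Y₁ × q ∈ Y₂ × ShareElem p q))

  Covers : ∀ {n} → Pairs n → Set
  Covers {n} Y = ∀ (x : Fin n) → ∃[ p ] (p ∈ Y × (proj₁ p ≡ x ⊎ proj₂ p ≡ x))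

-- Columns k and l of A are joined by a walk of length two in the bipartite
-- graph of Ã exactly when {k,l} lies in the support of some row, and two
-- such pairs that share an index glue their walks together.  So if Y is
-- connected for A and covers [n], all columns, hence (rows being nonzero)
-- all vertices, are reachable from one column.  Conversely a walk between
-- two columns is shadowed by a chain of overlapping supported pairs; the
-- pairs on the chains from a fixed column to every other column form a
-- covering set that is connected, because any set which is connected in the
-- graph-theoretic sense meets every splitting Y = Y₁ ∪ Y₂ in an overlap.
module Submission where

open import Defs
open import Level using (Level; _⊔_; Lift; lift; lower)
open import Data.Nat using (ℕ; _≤_; _+_; suc; s≤s)
open import Data.Nat.Properties using (≤-refl; ≤-trans)
open import Data.Fin using (Fin; zero; splitAt; _↑ˡ_; _↑ʳ_)
open import Data.Fin.Properties using (splitAt-↑ˡ; splitAt-↑ʳ; splitAt⁻¹-↑ˡ; splitAt⁻¹-↑ʳ)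
  renaming (_≟_ to _≟ᶠ_)
open import Data.Empty using (⊥-elim)
open import Data.Product using (_×_; ∃-syntax; _,_; proj₁; proj₂)
open import Data.Product.Properties using (≡-dec)
open import Data.Sum using (_⊎_; inj₁; inj₂)
open import Data.List using (List; []; _∷_; length; filter; concat; tabulate)
open import Data.List.Properties using (filter-notAll)
open import Data.List.Membership.Propositional using (_∈_)
open import Data.List.Membership.Propositional.Properties
  using (∈-filter⁺; ∈-filter⁻; ∈-concat⁺′; ∈-concat⁻′; ∈-tabulate⁺; ∈-tabulate⁻)
open import Data.List.Relation.Binary.Subset.Propositional using (_⊆_)
open import Data.List.Relation.Unary.Any using (here; there)
import Data.List.Relation.Unary.Any as Any
open import Function using (id)
open import Function.Bundles using (_⇔_; mk⇔)
open import Relation.Nullary using (yes; no; ¬?)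
open import Relation.Binary.Core using (Rel)
open import Relation.Binary.Definitions using (Reflexive; Symmetric; DecidableEquality)
open import Relation.Binary.PropositionalEquality using (_≡_; refl; sym; subst)
open import Relation.Binary.Construct.Closure.ReflexiveTransitive
  using (Star; ε; _◅_; _◅◅_; reverse)

module _ {a r} {A : Set a} {R : Rel A r} where

  vertices : ∀ {x y} → Star R x y → List A
  vertices {x} ε       = x ∷ []
  vertices {x} (_ ◅ s) = x ∷ vertices s

  source∈vertices : ∀ {x y} (s : Star R x y) → x ∈ vertices s
  source∈vertices ε       = here refl
  source∈vertices (_ ◅ _) = here refl

  target∈vertices : ∀ {x y} (s : Star R x y) → y ∈ vertices s
  target∈vertices ε       = here refl
  target∈vertices (_ ◅ s) = there (target∈vertices s)

  vertices-satisfy : ∀ {p} (P : A → Set p) → (∀ {x y} → R x y → P y) →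
                     ∀ {x y} → P x → (s : Star R x y) → ∀ {z} → z ∈ vertices s → P z
  vertices-satisfy P step Px ε       (here refl) = Px
  vertices-satisfy P step Px (_ ◅ s) (here refl) = Px
  vertices-satisfy P step Px (e ◅ s) (there z∈) = vertices-satisfy P step (step e) s z∈

  star-simulate : ∀ {b s i} {B : Set b} {S : Rel B s} (I : B → A → Set i) →
                  (∀ {u w p} → R u w → I p u → ∃[ p′ ] (Star S p p′ × I p′ w)) →
                  ∀ {u v p} → Star R u v → I p u → ∃[ p′ ] (Star S p p′ × I p′ v)
  star-simulate I step ε       Ipu = _ , ε , Ipu
  star-simulate I step (e ◅ s) Ipu =
    let p₁ , s₁ , I₁ = step e Ipu
        p₂ , s₂ , I₂ = star-simulate I step s I₁
    in  p₂ , s₁ ◅◅ s₂ , I₂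

  star-via-root : Symmetric R → ∀ {root} → (∀ v → Star R root v) → ∀ u v → Star R u v
  star-via-root R-sym from-root u v = reverse R-sym (from-root u) ◅◅ from-root v

module CutConnectivity {a r} {A : Set a} (_~_ : Rel A r) where

  Induced : List A → Rel A (a ⊔ r)
  Induced Y x y = x ∈ Y × y ∈ Y × x ~ y

  -- Clause (ii) of ConnectedFor, for an arbitrary relation in place of ShareElem.
  CutConnected : List A → Set (a ⊔ r)
  CutConnected Y =
    ∀ (Y₁ Y₂ : List A) → ∃[ p ] (p ∈ Y₁) → ∃[ q ] (q ∈ Y₂) →
    (∀ p → (p ∈ Y → p ∈ Y₁ ⊎ p ∈ Y₂) × (p ∈ Y₁ ⊎ p ∈ Y₂ → p ∈ Y)) →
    ∃[ p ] ∃[ q ] (p ∈ Y₁ × q ∈ Y₂ × p ~ q)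

  induced-target∈ : ∀ {Y x y} → x ∈ Y → Star (Induced Y) x y → y ∈ Y
  induced-target∈ x∈ ε                  = x∈
  induced-target∈ x∈ ((_ , y∈ , _) ◅ s) = induced-target∈ y∈ s

  induced-reverse : Symmetric _~_ → ∀ {Y} → Symmetric (Induced Y)
  induced-reverse ~-sym (x∈ , y∈ , x~y) = y∈ , x∈ , ~-sym x~y

  vertices-induced : ∀ {s} {R : Rel A s} → (∀ {x y} → R x y → x ~ y) →
                     ∀ {Y x y} (s : Star R x y) → vertices s ⊆ Y →
                     ∀ {z} → z ∈ vertices s → Star (Induced Y) x z
  vertices-induced R⇒~ ε       ⊆Y (here refl) = ε
  vertices-induced R⇒~ (e ◅ s) ⊆Y (here refl) = ε
  vertices-induced R⇒~ (e ◅ s) ⊆Y (there z∈) =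
    (⊆Y (here refl) , ⊆Y (there (source∈vertices s)) , R⇒~ e)
      ◅ vertices-induced R⇒~ s (λ w∈ → ⊆Y (there w∈)) z∈

  reachable⇒cutConnected : Reflexive _~_ → Symmetric _~_ → ∀ {Y p₀} → p₀ ∈ Y →
                           (∀ {q} → q ∈ Y → Star (Induced Y) p₀ q) → CutConnected Y
  reachable⇒cutConnected ~-refl ~-sym {Y} p₀∈ reach Y₁ Y₂ (p , p∈₁) (q , q∈₂) split =
    crossing p∈₁ q∈₂
      (reverse (induced-reverse ~-sym) (reach (proj₂ (split p) (inj₁ p∈₁)))
        ◅◅ reach (proj₂ (split q) (inj₂ q∈₂)))
    where
    crossing : ∀ {x y} → x ∈ Y₁ → y ∈ Y₂ → Star (Induced Y) x y →
               ∃[ p ] ∃[ q ] (p ∈ Y₁ × q ∈ Y₂ × p ~ q)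
    crossing x∈₁ y∈₂ ε = _ , _ , x∈₁ , y∈₂ , ~-refl
    crossing x∈₁ y∈₂ ((_ , z∈ , x~z) ◅ s) with proj₁ (split _) z∈
    ... | inj₁ z∈₁ = crossing z∈₁ y∈₂ s
    ... | inj₂ z∈₂ = _ , _ , x∈₁ , z∈₂ , x~z

  -- The reached part S grows: the cut between S and the rest R of Y is
  -- crossed by an edge, whose endpoint in R moves to S; length R is the measure.
  cutConnected⇒reachable : DecidableEquality A → ∀ {Y p₀} → CutConnected Y → p₀ ∈ Y →
                           ∀ {q} → q ∈ Y → Star (Induced Y) p₀ q
  cutConnected⇒reachable _≟_ {Y} {p₀} cut p₀∈ =
    grow (length Y) (p₀ ∷ []) Y ≤-refl (λ { (here refl) → ε }) (here refl) id inj₂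
    where
    Reached : A → Set (a ⊔ r)
    Reached = Star (Induced Y) p₀

    grow : ∀ fuel (S R : List A) → length R ≤ fuel →
           (∀ {z} → z ∈ S → Reached z) → p₀ ∈ S → R ⊆ Y →
           (∀ {z} → z ∈ Y → z ∈ S ⊎ z ∈ R) → ∀ {z} → z ∈ Y → Reached z
    grow _ S [] _ reachedS _ _ cover z∈ with cover z∈
    ... | inj₁ z∈S = reachedS z∈S
    ... | inj₂ ()
    grow (suc fuel) S (r ∷ rs) (s≤s len≤) reachedS p₀∈S R⊆Y cover
      with cut S (r ∷ rs) (p₀ , p₀∈S) (r , here refl)
               (λ w → cover , λ { (inj₁ w∈S) → S⊆Y w∈S ; (inj₂ w∈R) → R⊆Y w∈R })
      where
      S⊆Y : S ⊆ Y
      S⊆Y w∈S = induced-target∈ p₀∈ (reachedS w∈S)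
    ... | p , q , p∈S , q∈R , p~q =
      grow fuel (q ∷ S) R′ len′≤ reachedS′ (there p₀∈S) (λ w∈ → R⊆Y (proj₁ (∈-filter⁻ ≢q? w∈)))
           cover′
      where
      ≢q? = λ (w : A) → ¬? (w ≟ q)
      R′ = filter ≢q? (r ∷ rs)

      len′≤ : length R′ ≤ fuel
      len′≤ with filter-notAll ≢q? (r ∷ rs) (Any.map (λ q≡w w≢q → w≢q (sym q≡w)) q∈R)
      ... | s≤s le = ≤-trans le len≤

      reachedS′ : ∀ {w} → w ∈ q ∷ S → Reached w
      reachedS′ (here refl) = reachedS p∈S ◅◅
        (induced-target∈ p₀∈ (reachedS p∈S) , R⊆Y q∈R , p~q) ◅ ε
      reachedS′ (there w∈S) = reachedS w∈S

      cover′ : ∀ {w} → w ∈ Y → w ∈ q ∷ S ⊎ w ∈ R′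
      cover′ {w} w∈ with cover w∈
      ... | inj₁ w∈S = inj₁ (there w∈S)
      ... | inj₂ w∈R with w ≟ q
      ...   | yes w≡q = inj₁ (here w≡q)
      ...   | no  w≢q = inj₂ (∈-filter⁺ ≢q? w∈R w≢q)

module _ {c ℓ : Level} (K : Field c ℓ) {m n : ℕ} (A : Matrix K m n) where
  open CutConnectivity (ShareElem K {n})

  Adj : Rel (Fin (m + n)) ℓ
  Adj = SymOne K A

  col : Fin n → Fin (m + n)
  col x = m ↑ʳ x

  row : Fin m → Fin (m + n)
  row j = j ↑ˡ n

  adj-col-row : ∀ {j x} → InSupp K A j x → Adj (col x) (row j)
  adj-col-row {j} {x} h rewrite splitAt-↑ʳ m n x | splitAt-↑ˡ m j n = h

  adj-row-col : ∀ {j x} → InSupp K A j x → Adj (row j) (col x)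
  adj-row-col {j} {x} h rewrite splitAt-↑ʳ m n x | splitAt-↑ˡ m j n = h

  adj-sym : Symmetric Adj
  adj-sym {u} {v} h with splitAt m u | splitAt m v
  ... | inj₁ _ | inj₁ _ = h
  ... | inj₁ _ | inj₂ _ = h
  ... | inj₂ _ | inj₁ _ = h
  ... | inj₂ _ | inj₂ _ = h

  cols-via-row : ∀ {j x y} → InSupp K A j x → InSupp K A j y → Star Adj (col x) (col y)
  cols-via-row hx hy = adj-col-row hx ◅ adj-row-col hy ◅ ε

  _∈ᵖ_ : Fin n → Fin n × Fin n → Set
  x ∈ᵖ p = proj₁ p ≡ x ⊎ proj₂ p ≡ x

  SupportedPair : Fin n × Fin n → Set ℓ
  SupportedPair (k , l) = ∃[ j ] (InSupp K A j k × InSupp K A j l)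

  share-refl : Reflexive (ShareElem K {n})
  share-refl = inj₁ (inj₁ refl)

  share-sym : Symmetric (ShareElem K {n})
  share-sym (inj₁ (inj₁ e)) = inj₁ (inj₁ (sym e))
  share-sym (inj₁ (inj₂ e)) = inj₂ (inj₁ (sym e))
  share-sym (inj₂ (inj₁ e)) = inj₁ (inj₂ (sym e))
  share-sym (inj₂ (inj₂ e)) = inj₂ (inj₂ (sym e))

  supported-cols-reachable : ∀ {x p} → SupportedPair p → x ∈ᵖ p →
                             Star Adj (col x) (col (proj₁ p)) × Star Adj (col x) (col (proj₂ p))
  supported-cols-reachable {p = k , l} (j , hk , hl) (inj₁ refl) = ε , cols-via-row hk hl
  supported-cols-reachable {p = k , l} (j , hk , hl) (inj₂ refl) = cols-via-row hl hk , ε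

  module FromConnectedCover (rows-nonzero : ∀ j → ∃[ k ] InSupp K A j k)
                            (Y : List (Fin n × Fin n)) (connected : ConnectedFor K A Y)
                            (covers : Covers K Y) (x₀ : Fin n) where

    ColsReachable : Fin n × Fin n → Set ℓ
    ColsReachable (k , l) = Star Adj (col x₀) (col k) × Star Adj (col x₀) (col l)

    shared-col-reachable : ∀ {p q} → ColsReachable p → ShareElem K p q →
                           ∃[ x ] (Star Adj (col x₀) (col x) × x ∈ᵖ q)
    shared-col-reachable (r₁ , _) (inj₁ (inj₁ e)) = _ , r₁ , inj₁ (sym e)
    shared-col-reachable (r₁ , _) (inj₁ (inj₂ e)) = _ , r₁ , inj₂ (sym e)
    shared-col-reachable (_ , r₂) (inj₂ (inj₁ e)) = _ , r₂ , inj₁ (sym e)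
    shared-col-reachable (_ , r₂) (inj₂ (inj₂ e)) = _ , r₂ , inj₂ (sym e)

    cols-reachable-step : ∀ {p q} → ColsReachable p → ShareElem K p q → SupportedPair q →
                          ColsReachable q
    cols-reachable-step reach share supported =
      let x , r , x∈q = shared-col-reachable reach share
          r₁ , r₂     = supported-cols-reachable supported x∈q
      in  r ◅◅ r₁ , r ◅◅ r₂

    pairs-reachable : ∀ {q} → q ∈ Y → ColsReachable q
    pairs-reachable q∈ =
      along (cutConnected⇒reachable (≡-dec _≟ᶠ_ _≟ᶠ_) (proj₂ connected) p₀∈Y q∈)
            (supported-cols-reachable (proj₁ connected p₀∈Y) x₀∈p₀)
      where
      p₀∈Y = proj₁ (proj₂ (covers x₀))
      x₀∈p₀ = proj₂ (proj₂ (covers x₀))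

      along : ∀ {p q} → Star (Induced Y) p q → ColsReachable p → ColsReachable q
      along ε                          reach = reach
      along ((_ , q∈ , share) ◅ steps) reach =
        along steps (cols-reachable-step reach share (proj₁ connected q∈))

    cols-reachable : ∀ x → Star Adj (col x₀) (col x)
    cols-reachable x with covers x
    ... | p , p∈ , inj₁ refl = proj₁ (pairs-reachable p∈)
    ... | p , p∈ , inj₂ refl = proj₂ (pairs-reachable p∈)

    all-reachable : ∀ u → Star Adj (col x₀) u
    all-reachable u with splitAt m u in eq
    ... | inj₁ j = let k , hk = rows-nonzero j in
                   subst (Star Adj (col x₀)) (splitAt⁻¹-↑ˡ eq) (cols-reachable k ◅◅ adj-col-row hk ◅ ε)
    ... | inj₂ x = subst (Star Adj (col x₀)) (splitAt⁻¹-↑ʳ eq) (cols-reachable x)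

    irreducible : ZeroOneSymIrreducible K A
    irreducible = star-via-root adj-sym all-reachable

  OverlapStep : Rel (Fin n × Fin n) ℓ
  OverlapStep p q = ShareElem K p q × SupportedPair q

  -- A walk in the bipartite graph is shadowed by a chain of overlapping
  -- supported pairs: the current pair contains the current column, or meets
  -- the support of the current row.
  Tracks : Fin n × Fin n → Fin m ⊎ Fin n → Set ℓ
  Tracks p (inj₁ j) = ∃[ x ] (x ∈ᵖ p × InSupp K A j x)
  Tracks p (inj₂ x) = Lift ℓ (x ∈ᵖ p)

  share-∈ᵖ : ∀ {x p} y → x ∈ᵖ p → ShareElem K p (x , y)
  share-∈ᵖ y (inj₁ e) = inj₁ (inj₁ e)
  share-∈ᵖ y (inj₂ e) = inj₂ (inj₁ e)

  tracks-step : ∀ {u w p} → Adj u w → Tracks p (splitAt m u) →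
                ∃[ p′ ] (Star OverlapStep p p′ × Tracks p′ (splitAt m w))
  tracks-step {u} {w} {p} edge tracks with splitAt m u | splitAt m w
  ... | inj₁ _ | inj₁ _ = ⊥-elim (lower edge)
  ... | inj₁ j | inj₂ y = let x , x∈p , hx = tracks in
                          (x , y) , (share-∈ᵖ y x∈p , j , hx , edge) ◅ ε , lift (inj₂ refl)
  ... | inj₂ x | inj₁ j = p , ε , x , lower tracks , edge
  ... | inj₂ _ | inj₂ _ = ⊥-elim (lower edge)

  module FromIrreducible (irreducible : ZeroOneSymIrreducible K A)
                         {j₀ k₀} (hk₀ : InSupp K A j₀ k₀) where

    p₀ : Fin n × Fin n
    p₀ = k₀ , k₀

    chain-to : ∀ x → ∃[ p ] (Star OverlapStep p₀ p × x ∈ᵖ p)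
    chain-to x =
      let p , chain , tracks = star-simulate (λ p u → Tracks p (splitAt m u)) tracks-step
                                 (irreducible (col k₀) (col x))
                                 (subst (Tracks p₀) (sym (splitAt-↑ʳ m n k₀)) (lift (inj₁ refl)))
      in  p , chain , lower (subst (Tracks p) (splitAt-↑ʳ m n x) tracks)

    chain : ∀ x → Star OverlapStep p₀ (proj₁ (chain-to x))
    chain x = proj₁ (proj₂ (chain-to x))

    chain-vertices : Fin n → List (Fin n × Fin n)
    chain-vertices x = vertices (chain x)

    chains : List (Fin n × Fin n)
    chains = concat (tabulate chain-vertices)

    Y : List (Fin n × Fin n)
    Y = p₀ ∷ chains

    chain⊆Y : ∀ x → vertices (chain x) ⊆ Y
    chain⊆Y x z∈ = there (∈-concat⁺′ z∈ (∈-tabulate⁺ x))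

    ∈chains⁻ : ∀ {q} → q ∈ chains → ∃[ x ] (q ∈ vertices (chain x))
    ∈chains⁻ q∈ with ∈-concat⁻′ (tabulate chain-vertices) q∈
    ... | _ , q∈vs , vs∈ with ∈-tabulate⁻ {f = chain-vertices} vs∈
    ...   | x , refl = x , q∈vs

    supported : ∀ {q} → q ∈ Y → SupportedPair q
    supported (here refl) = j₀ , hk₀ , hk₀
    supported (there q∈) =
      let x , q∈chain = ∈chains⁻ q∈
      in  vertices-satisfy SupportedPair proj₂ (supported (here refl)) (chain x) q∈chain

    reachable : ∀ {q} → q ∈ Y → Star (Induced Y) p₀ q
    reachable (here refl) = ε
    reachable (there q∈) =
      let x , q∈chain = ∈chains⁻ q∈
      in  vertices-induced proj₁ (chain x) (chain⊆Y x) q∈chain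

    connected : ConnectedFor K A Y
    connected = (λ q∈ → supported q∈) ,
                reachable⇒cutConnected share-refl share-sym (here refl) reachable

    covers : Covers K Y
    covers x = let p , chain , x∈p = chain-to x in p , chain⊆Y x (target∈vertices chain) , x∈p

lemma3p4 : ∀ {c ℓ : Level} (K : Field c ℓ) (m n : ℕ) (A : Matrix K m n) →
           1 ≤ m →
           (∀ (j : Fin m) → ∃[ k ] InSupp K A j k) →
           ZeroOneSymIrreducible K A ⇔ (∃[ Y ] (ConnectedFor K A Y × Covers K Y))
lemma3p4 K (suc m) n A _ rows-nonzero = mk⇔
  (λ irreducible → let open FromIrreducible K A irreducible (proj₂ (rows-nonzero zero))
                   in  Y , connected , covers)
  (λ (Y , connected , covers) →
     FromConnectedCover.irreducible K A rows-nonzero Y connected covers (proj₁ (rows-nonzero zero)))
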